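{- Let $k \ge 2$ be an integer, and let $G$ be a graph of odd order $n$. If $\beta^k(G) \ge 1$, then $G$ is hypomatchable.
   Context: All graphs are finite and simple. $G$ is hypomatchable if $G-v$ has a perfect matching for every vertex $v$. For $S\subseteq V(G)$, $\Lambda^k_G(S)$ is the set of vertices with at least $k$ neighbors in $S$, and $\beta^k(G)=\min\{|\Lambda^k_G(S)|/|S| : S\subseteq V(G),\ |S|\ge k,\ \Lambda^k_G(S)\ne V(G)\}$, with $\beta^k(G)=0$ if $|V(G)|<k$. -}

module Defs where

open import Data.Nat using (ℕ; _≤_; _*_)
open import Data.Nat.Properties using ()
open import Data.Fin using (Fin)
open import Data.Fin.Subset using (Subset; ∣_∣; _∈_; _∩_; ⁅_⁆; ⊤)
open import Data.Fin.Subset.Properties using (_∈?_)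
open import Data.Bool using (Bool; true; false; if_then_else_)
open import Data.Vec using (tabulate)
open import Data.Product using (Σ; _×_; _,_)
open import Relation.Nullary using (¬_; Dec; does)
open import Relation.Binary.PropositionalEquality using (_≡_; _≢_)

record Graph (n : ℕ) : Set₁ where
  field
    Adj      : Fin n → Fin n → Set
    adj?     : ∀ u v → Dec (Adj u v)
    sym      : ∀ {u v} → Adj u v → Adj v u
    irrefl   : ∀ {u} → ¬ Adj u u

open Graph public

nbhd : ∀ {n} → Graph n → Fin n → Subset n
nbhd G v = tabulate (λ u → does (adj? G v u))

Λ : ∀ {n} → ℕ → Graph n → Subset n → Subset n
Λ k G S = tabulate (λ v → does (Data.Nat._≤?_ k ∣ nbhd G v ∩ S ∣))

-- β^k(G) ≥ 1, unfolded from the definition: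
-- β^k(G) = 0 if n < k, so β^k(G) ≥ 1 requires k ≤ n; then the minimum of
-- |Λ^k(S)|/|S| over S with |S| ≥ k and Λ^k(S) ≠ V(G) is ≥ 1, i.e. every such
-- S satisfies |S| ≤ |Λ^k(S)|.  (For k ≤ n the index set is nonempty: any
-- S with |S| = k has no vertex of S in Λ^k(S).)
βGe1 : ∀ {n} → ℕ → Graph n → Set
βGe1 {n} k G =
  k ≤ n ×
  ((S : Subset n) → k ≤ ∣ S ∣ → Λ k G S ≢ ⊤ → ∣ S ∣ ≤ ∣ Λ k G S ∣)

-- A perfect matching of G - v, encoded as an involution m on V(G) with
-- m v = v and, for every u ≠ v, m u ≠ u and u adjacent to m u
-- (the matching is the set of edges {u, m u}, u ≠ v).
PerfectMatchingMinus : ∀ {n} → Graph n → Fin n → Set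
PerfectMatchingMinus {n} G v =
  Σ (Fin n → Fin n) λ m →
    ((u : Fin n) → m (m u) ≡ u) ×
    (m v ≡ v) ×
    ((u : Fin n) → u ≢ v → Adj G u (m u))

Hypomatchable : ∀ {n} → Graph n → Set
Hypomatchable {n} G = (v : Fin n) → PerfectMatchingMinus G v

-- Fix v and let W = V(G) − v, so |W| = 2m. Take X ⊆ V(G) and a set T of vertices of W ─ X lying
-- in pairwise different components of G[W] − X. A vertex with two neighbours in T joins two of
-- these components, so it lies in X ∪ {v}. If |T| ≥ k, every vertex of Λᵏ(T) has two neighbours
-- in T; if |T| < k, enlarge T to a k-set S, whose Λᵏ(S) consists of common neighbours of all of S.
-- Either way β^k(G) ≥ 1 gives |T| ≤ |Λᵏ| ≤ |X| + 1, i.e. G[W] − X has at most |X| + 1 components.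
-- As |W| is even, this implies Tutte's condition, and G[W] has a perfect matching by Lovász's
-- proof of Tutte's theorem: induct on the number of missing edges. If some vertex b of W misses a
-- vertex d of W and has non-adjacent neighbours a, c, then perfect matchings of G + ac and G + bd
-- are combined along their alternating cycle through bd. Otherwise the vertices adjacent to all
-- of W (the universal ones) are removed and the rest is a disjoint union of cliques; they are
-- matched inside the cliques as far as possible, and the leftover vertices (an independent set,
-- hence at most as many as the universal ones by the component bound and parity) to universal ones.

module Submission where

open import Defs renaming (sym to Adj-sym)
open import Data.Nat using (ℕ; _≤_; _*_; suc; zero; _+_; _∸_; _<_; z≤n; s≤s; s≤s⁻¹; _≤?_)
open import Data.Nat.Properties hiding (_≟_)
open import Data.Nat.Divisibility using (_∣_; divides; ∣m+n∣m⇒∣n; n∣n; ∣1⇒≡1)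
open import Data.Nat.GeneralisedArithmetic using (fold; fold-+)
open import Data.Nat.Induction using (<-wellFounded)
open import Data.Fin using (Fin; zero; suc; _≟_; toℕ)
open import Data.Fin.Properties using (any?; all?; ¬∀⟶∃¬; pigeonhole)
open import Data.Fin.Permutation.Components using (transpose)
open import Data.Fin.Subset
  using (Subset; ∣_∣; _∈_; _∉_; _⊆_; _⊂_; _∩_; _∪_; _─_; _-_; ⁅_⁆; ⊤; Nonempty; Empty; inside; outside)
open import Data.Fin.Subset.Properties
open import Data.Fin.Subset.Induction using (⊂-wellFounded; Acc; acc)
open import Data.Vec using ([]; _∷_; tabulate; sum; here; there)
open import Data.Vec.Properties using (lookup∘tabulate; lookup⇒[]=; []=⇒lookup)
open import Data.Product using (∃; ∃₂; _×_; _,_; proj₁; proj₂; map₁)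
open import Data.Sum using (_⊎_; inj₁; inj₂)
open import Function using (_∘_; id)
open import Level using (Level)
open import Relation.Binary.Construct.Closure.ReflexiveTransitive as Star using (Star; ε; _◅_)
open import Relation.Binary.PropositionalEquality
open import Relation.Nullary using (¬_; Dec; yes; no; does; contradiction; _×-dec_; _⊎-dec_; _→-dec_; ¬?)
open import Relation.Nullary.Decidable using (dec-true)
open import Relation.Unary using (Pred; Decidable)

private
  variable
    ℓ : Level
    n : ℕ
    p q : Subset n
    x y z : Fin n

select : {P : Pred (Fin n) ℓ} → Decidable P → Subset n
select P? = tabulate (does ∘ P?)

∈-select⁺ : {P : Pred (Fin n) ℓ} (P? : Decidable P) → P x → x ∈ select P?
∈-select⁺ {x = x} P? px = lookup⇒[]= x _ (trans (lookup∘tabulate _ x) (dec-true (P? x) px))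

∈-select⁻ : {P : Pred (Fin n) ℓ} (P? : Decidable P) → x ∈ select P? → P x
∈-select⁻ {x = x} P? x∈ with P? x | trans (sym (lookup∘tabulate (does ∘ P?) x)) ([]=⇒lookup x∈)
... | yes px | _ = px
... | no _   | ()

x∈q⇒x∉p─q : ∀ {p q : Subset n} → x ∈ q → x ∉ p ─ q
x∈q⇒x∉p─q {p = _       ∷ p}                 here        ()
x∈q⇒x∉p─q {p = inside  ∷ p} {q = outside ∷ q} (there x∈q) (there x∈p─q) = x∈q⇒x∉p─q x∈q x∈p─q
x∈q⇒x∉p─q {p = outside ∷ p} {q = outside ∷ q} (there x∈q) (there x∈p─q) = x∈q⇒x∉p─q x∈q x∈p─q
x∈q⇒x∉p─q {p = _       ∷ p} {q = inside  ∷ q} (there x∈q) (there x∈p─q) = x∈q⇒x∉p─q x∈q x∈p─q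

x∈p─q⁻ : ∀ (p q : Subset n) → x ∈ p ─ q → x ∈ p × x ∉ q
x∈p─q⁻ p q x∈ = p─q⊆p p q x∈ , λ x∈q → x∈q⇒x∉p─q x∈q x∈

x∈p-y⁻ : ∀ (p : Subset n) y → x ∈ p - y → x ∈ p × x ≢ y
x∈p-y⁻ p y x∈ with x∈p─q⁻ p ⁅ y ⁆ x∈
... | x∈p , x∉⁅y⁆ = x∈p , x∉⁅y⁆⇒x≢y x∉⁅y⁆

x∈p-y-z⁻ : ∀ {p : Subset n} → x ∈ p - y - z → x ∈ p × x ≢ y × x ≢ z
x∈p-y-z⁻ {y = y} {z} {p} x∈ with x∈p-y⁻ (p - y) z x∈
... | x∈p-y , x≢z = proj₁ (x∈p-y⁻ p y x∈p-y) , proj₂ (x∈p-y⁻ p y x∈p-y) , x≢z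

x∈p-y-z⁺ : ∀ {p : Subset n} → x ∈ p → x ≢ y → x ≢ z → x ∈ p - y - z
x∈p-y-z⁺ x∈p x≢y x≢z = x∈p∧x≢y⇒x∈p-y (x∈p∧x≢y⇒x∈p-y x∈p x≢y) x≢z

∈-pair⁺ : z ≡ x ⊎ z ≡ y → z ∈ ⁅ x ⁆ ∪ ⁅ y ⁆
∈-pair⁺ (inj₁ refl) = x∈p∪q⁺ (inj₁ (x∈⁅x⁆ _))
∈-pair⁺ (inj₂ refl) = x∈p∪q⁺ (inj₂ (x∈⁅x⁆ _))

∈-pair⁻ : z ∈ ⁅ x ⁆ ∪ ⁅ y ⁆ → z ≡ x ⊎ z ≡ y
∈-pair⁻ {x = x} {y} z∈ with x∈p∪q⁻ ⁅ x ⁆ ⁅ y ⁆ z∈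
... | inj₁ z∈⁅x⁆ = inj₁ (x∈⁅y⁆⇒x≡y x z∈⁅x⁆)
... | inj₂ z∈⁅y⁆ = inj₂ (x∈⁅y⁆⇒x≡y y z∈⁅y⁆)

p-x-y⊂p : ∀ {p : Subset n} y → x ∈ p → p - x - y ⊂ p
p-x-y⊂p {x = x} {p} y x∈p = ⊆-⊂-trans (p─q⊆p (p - x) ⁅ y ⁆) (x∈p⇒p-x⊂p x∈p)

p-x-y─q⊆p─q-x : ∀ (p q : Subset n) x y → p - x - y ─ q ⊆ (p ─ q) - x
p-x-y─q⊆p─q-x p q x y z∈ with x∈p─q⁻ (p - x - y) q z∈
... | z∈p-x-y , z∉q with x∈p-y-z⁻ z∈p-x-y
...   | z∈p , z≢x , _ = x∈p∧x≢y⇒x∈p-y (x∈p∧x∉q⇒x∈p─q z∈p z∉q) z≢x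

p∩q-y⊆p-x-y∩q : ∀ (p q : Subset n) y → x ∉ q → (p ∩ q) - y ⊆ (p - x - y) ∩ q
p∩q-y⊆p-x-y∩q p q y x∉q z∈ with x∈p-y⁻ (p ∩ q) y z∈
... | z∈p∩q , z≢y with x∈p∩q⁻ p q z∈p∩q
...   | z∈p , z∈q = x∈p∩q⁺ (x∈p-y-z⁺ z∈p (λ { refl → x∉q z∈q }) z≢y , z∈q)

p∩q⊆p-x-y∩q : ∀ (p q : Subset n) → x ∉ q → y ∉ q → p ∩ q ⊆ (p - x - y) ∩ q
p∩q⊆p-x-y∩q p q x∉q y∉q z∈ with x∈p∩q⁻ p q z∈
... | z∈p , z∈q = x∈p∩q⁺ (x∈p-y-z⁺ z∈p (λ { refl → x∉q z∈q }) (λ { refl → y∉q z∈q }) , z∈q)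

∣p∣≡1+∣p-x∣ : x ∈ p → ∣ p ∣ ≡ suc ∣ p - x ∣
∣p∣≡1+∣p-x∣ {p = inside  ∷ p} here        = cong (suc ∘ ∣_∣) (sym (p─⊥≡p p))
∣p∣≡1+∣p-x∣ {p = inside  ∷ p} (there x∈p) = cong suc (∣p∣≡1+∣p-x∣ x∈p)
∣p∣≡1+∣p-x∣ {p = outside ∷ p} (there x∈p) = ∣p∣≡1+∣p-x∣ x∈p

∣p∣≡2+∣p-x-y∣ : x ∈ p → y ∈ p - x → ∣ p ∣ ≡ 2 + ∣ p - x - y ∣
∣p∣≡2+∣p-x-y∣ x∈p y∈p-x = trans (∣p∣≡1+∣p-x∣ x∈p) (cong suc (∣p∣≡1+∣p-x∣ y∈p-x))

∣p∣≡∣p∩q∣+∣p─q∣ : ∀ (p q : Subset n) → ∣ p ∣ ≡ ∣ p ∩ q ∣ + ∣ p ─ q ∣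
∣p∣≡∣p∩q∣+∣p─q∣ []            []            = refl
∣p∣≡∣p∩q∣+∣p─q∣ (inside  ∷ p) (inside  ∷ q) = cong suc (∣p∣≡∣p∩q∣+∣p─q∣ p q)
∣p∣≡∣p∩q∣+∣p─q∣ (inside  ∷ p) (outside ∷ q) = trans (cong suc (∣p∣≡∣p∩q∣+∣p─q∣ p q)) (sym (+-suc _ _))
∣p∣≡∣p∩q∣+∣p─q∣ (outside ∷ p) (inside  ∷ q) = ∣p∣≡∣p∩q∣+∣p─q∣ p q
∣p∣≡∣p∩q∣+∣p─q∣ (outside ∷ p) (outside ∷ q) = ∣p∣≡∣p∩q∣+∣p─q∣ p q

∣p∪q∣≤∣p∣+∣q∣ : ∀ (p q : Subset n) → ∣ p ∪ q ∣ ≤ ∣ p ∣ + ∣ q ∣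
∣p∪q∣≤∣p∣+∣q∣ []            []            = z≤n
∣p∪q∣≤∣p∣+∣q∣ (inside  ∷ p) (inside  ∷ q) = s≤s (≤-trans (∣p∪q∣≤∣p∣+∣q∣ p q) (+-monoʳ-≤ ∣ p ∣ (n≤1+n _)))
∣p∪q∣≤∣p∣+∣q∣ (inside  ∷ p) (outside ∷ q) = s≤s (∣p∪q∣≤∣p∣+∣q∣ p q)
∣p∪q∣≤∣p∣+∣q∣ (outside ∷ p) (inside  ∷ q) =
  ≤-trans (s≤s (∣p∪q∣≤∣p∣+∣q∣ p q)) (≤-reflexive (sym (+-suc ∣ p ∣ ∣ q ∣)))
∣p∪q∣≤∣p∣+∣q∣ (outside ∷ p) (outside ∷ q) = ∣p∪q∣≤∣p∣+∣q∣ p q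

x∉p⇒∣p∪⁅x⁆∣≡1+∣p∣ : x ∉ p → ∣ p ∪ ⁅ x ⁆ ∣ ≡ suc ∣ p ∣
x∉p⇒∣p∪⁅x⁆∣≡1+∣p∣ {x = zero}  {outside ∷ p} _   = cong (suc ∘ ∣_∣) (∪-identityʳ p)
x∉p⇒∣p∪⁅x⁆∣≡1+∣p∣ {x = zero}  {inside  ∷ p} x∉p = contradiction here x∉p
x∉p⇒∣p∪⁅x⁆∣≡1+∣p∣ {x = suc x} {inside  ∷ p} x∉p = cong suc (x∉p⇒∣p∪⁅x⁆∣≡1+∣p∣ (x∉p ∘ there))
x∉p⇒∣p∪⁅x⁆∣≡1+∣p∣ {x = suc x} {outside ∷ p} x∉p = x∉p⇒∣p∪⁅x⁆∣≡1+∣p∣ (x∉p ∘ there)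

x∈p⇒0<∣p∣ : x ∈ p → 0 < ∣ p ∣
x∈p⇒0<∣p∣ x∈p = subst (0 <_) (sym (∣p∣≡1+∣p-x∣ x∈p)) (s≤s z≤n)

Empty⇒∣p∣≡0 : ∀ {p : Subset n} → Empty p → ∣ p ∣ ≡ 0
Empty⇒∣p∣≡0 {n} ¬ne = trans (cong ∣_∣ (Empty-unique ¬ne)) (∣⊥∣≡0 n)

0<∣p∣⇒Nonempty : ∀ {p : Subset n} → 0 < ∣ p ∣ → Nonempty p
0<∣p∣⇒Nonempty {p = p} 0<∣p∣ with nonempty? p
... | yes ne = ne
... | no ¬ne = contradiction (Empty⇒∣p∣≡0 ¬ne) (>⇒≢ 0<∣p∣)

∣p∣<n⇒∃∉ : ∀ {p : Subset n} → ∣ p ∣ < n → ∃ λ x → x ∉ p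
∣p∣<n⇒∃∉ {p = p} ∣p∣<n with 0<∣p∣⇒Nonempty (subst (0 <_) (sym (∣∁p∣≡n∸∣p∣ p)) (m<n⇒0<n∸m ∣p∣<n))
... | x , x∈∁p = x , x∈∁p⇒x∉p x∈∁p

2≤∣p∣⇒∃-pair : 2 ≤ ∣ p ∣ → ∃₂ λ x y → x ∈ p × y ∈ p × x ≢ y
2≤∣p∣⇒∃-pair {p = p} 2≤∣p∣ with 0<∣p∣⇒Nonempty (≤-trans (s≤s z≤n) 2≤∣p∣)
... | x , x∈p with 0<∣p∣⇒Nonempty {p = p - x} (s≤s⁻¹ (subst (2 ≤_) (∣p∣≡1+∣p-x∣ x∈p) 2≤∣p∣))
...   | y , y∈p-x with x∈p-y⁻ p x y∈p-x
...     | y∈p , y≢x = x , y , x∈p , y∈p , y≢x ∘ sym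

2∣∣p∣⇒Nonempty[p-x] : x ∈ p → 2 ∣ ∣ p ∣ → Nonempty (p - x)
2∣∣p∣⇒Nonempty[p-x] {x = x} {p} x∈p 2∣∣p∣ = 0<∣p∣⇒Nonempty (n≢0⇒n>0 ∣p-x∣≢0)
  where
  ∣p-x∣≢0 : ∣ p - x ∣ ≢ 0
  ∣p-x∣≢0 ∣p-x∣≡0 =
    contradiction (∣1⇒≡1 (subst (2 ∣_) (trans (∣p∣≡1+∣p-x∣ x∈p) (cong suc ∣p-x∣≡0)) 2∣∣p∣)) λ ()

2∣∣p-x-y∣ : x ∈ p → y ∈ p - x → 2 ∣ ∣ p ∣ → 2 ∣ ∣ p - x - y ∣
2∣∣p-x-y∣ x∈p y∈p-x 2∣∣p∣ = ∣m+n∣m⇒∣n (subst (2 ∣_) (∣p∣≡2+∣p-x-y∣ x∈p y∈p-x) 2∣∣p∣) (n∣n {2})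

2∣m+n∧n≤1+m⇒n≤m : ∀ {m n} → 2 ∣ m + n → n ≤ suc m → n ≤ m
2∣m+n∧n≤1+m⇒n≤m {m} 2∣m+n n≤1+m with m≤n⇒m<n∨m≡n n≤1+m
... | inj₁ n<1+m = s≤s⁻¹ n<1+m
... | inj₂ refl with 2∣m+n
...   | divides h m+1+m≡h*2 = contradiction 2h≡1+2m (even≢odd h m)
  where
  2h≡1+2m : 2 * h ≡ suc (2 * m)
  2h≡1+2m = trans (*-comm 2 h) (trans (sym m+1+m≡h*2)
              (trans (+-suc m m) (cong (λ k → suc (m + k)) (sym (+-identityʳ m)))))

⊇-ofSize : ∀ {p : Subset n} j → ∣ p ∣ ≤ j → j ≤ n → ∃ λ q → p ⊆ q × ∣ q ∣ ≡ j
⊇-ofSize {p = p} zero ∣p∣≤0 _ = p , id , n≤0⇒n≡0 ∣p∣≤0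
⊇-ofSize {p = p} (suc j) ∣p∣≤1+j 1+j≤n with m≤n⇒m<n∨m≡n ∣p∣≤1+j
... | inj₂ ∣p∣≡1+j = p , id , ∣p∣≡1+j
... | inj₁ ∣p∣<1+j with ⊇-ofSize j (s≤s⁻¹ ∣p∣<1+j) (<⇒≤ 1+j≤n)
...   | q , p⊆q , ∣q∣≡j with ∣p∣<n⇒∃∉ (subst (_< _) (sym ∣q∣≡j) 1+j≤n)
...     | x , x∉q =
  q ∪ ⁅ x ⁆ , p⊆p∪q ⁅ x ⁆ ∘ p⊆q , trans (x∉p⇒∣p∪⁅x⁆∣≡1+∣p∣ {p = q} x∉q) (cong suc ∣q∣≡j)

∣q∣≤∣p∩q∣⇒q⊆p : ∀ (p q : Subset n) → ∣ q ∣ ≤ ∣ p ∩ q ∣ → q ⊆ p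
∣q∣≤∣p∩q∣⇒q⊆p p q ∣q∣≤∣p∩q∣ {x} x∈q with x ∈? p
... | yes x∈p = x∈p
... | no  x∉p = contradiction ∣q∣≤∣p∩q∣ (<⇒≱ (begin-strict
    ∣ p ∩ q ∣ ≤⟨ p⊆q⇒∣p∣≤∣q∣ p∩q⊆q-x ⟩
    ∣ q - x ∣ <⟨ x∈p⇒∣p-x∣<∣p∣ x∈q ⟩
    ∣ q ∣     ∎))
  where
  open ≤-Reasoning
  p∩q⊆q-x : p ∩ q ⊆ q - x
  p∩q⊆q-x z∈p∩q with x∈p∩q⁻ p q z∈p∩q
  ... | z∈p , z∈q = x∈p∧x≢y⇒x∈p-y z∈q λ { refl → x∉p z∈p }

∣p-x-y─q∣≤∣p-x-y∩q∣ : ∀ (p q : Subset n) → x ∈ p ─ q → y ∈ p ∩ q → ∣ p ─ q ∣ ≤ ∣ p ∩ q ∣ →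
                      ∣ p - x - y ─ q ∣ ≤ ∣ (p - x - y) ∩ q ∣
∣p-x-y─q∣≤∣p-x-y∩q∣ {x = x} {y} p q x∈p─q y∈p∩q balanced = begin
  ∣ p - x - y ─ q ∣   ≤⟨ p⊆q⇒∣p∣≤∣q∣ (p-x-y─q⊆p─q-x p q x y) ⟩
  ∣ (p ─ q) - x ∣     ≤⟨ s≤s⁻¹ (subst₂ _≤_ (∣p∣≡1+∣p-x∣ x∈p─q) (∣p∣≡1+∣p-x∣ y∈p∩q) balanced) ⟩
  ∣ (p ∩ q) - y ∣     ≤⟨ p⊆q⇒∣p∣≤∣q∣ (p∩q-y⊆p-x-y∩q p q y (proj₂ (x∈p─q⁻ p q x∈p─q))) ⟩
  ∣ (p - x - y) ∩ q ∣ ∎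
  where open ≤-Reasoning

sum-tabulate-≤ : ∀ {f g : Fin n → ℕ} → (∀ i → f i ≤ g i) → sum (tabulate f) ≤ sum (tabulate g)
sum-tabulate-≤ {zero}  f≤g = z≤n
sum-tabulate-≤ {suc n} f≤g = +-mono-≤ (f≤g zero) (sum-tabulate-≤ (f≤g ∘ suc))

sum-tabulate-< : ∀ {f g : Fin n → ℕ} → (∀ i → f i ≤ g i) → ∀ j → f j < g j →
                 sum (tabulate f) < sum (tabulate g)
sum-tabulate-< f≤g zero    fj<gj = +-mono-<-≤ fj<gj (sum-tabulate-≤ (f≤g ∘ suc))
sum-tabulate-< f≤g (suc j) fj<gj = +-mono-≤-< (f≤g zero) (sum-tabulate-< (f≤g ∘ suc) j fj<gj)

least-witness : ∀ {P : Pred ℕ ℓ} → Decidable P → ∀ {i} → P i → ∃ λ i → P i × (∀ {k} → k < i → ¬ P k)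
least-witness {P = P} P? {i} Pi = go (<-wellFounded i) Pi
  where
  go : ∀ {i} → Acc _<_ i → P i → ∃ λ i → P i × (∀ {k} → k < i → ¬ P k)
  go {i} (acc rec) Pi with anyUpTo? P? i
  ... | yes (k , k<i , Pk) = go (rec k<i) Pk
  ... | no none            = i , Pi , λ k<i Pk → none (_ , k<i , Pk)

Adj⇒≢ : (G : Graph n) → Adj G x y → x ≢ y
Adj⇒≢ G xy refl = irrefl G xy

∈-nbhd⁺ : (G : Graph n) → Adj G x y → y ∈ nbhd G x
∈-nbhd⁺ G = ∈-select⁺ (adj? G _)

∈-nbhd⁻ : (G : Graph n) → y ∈ nbhd G x → Adj G x y
∈-nbhd⁻ G = ∈-select⁻ (adj? G _)

∈-Λ⁻ : ∀ {k} (G : Graph n) S → x ∈ Λ k G S → k ≤ ∣ nbhd G x ∩ S ∣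
∈-Λ⁻ {k = k} G S = ∈-select⁻ (λ u → k ≤? ∣ nbhd G u ∩ S ∣)

addEdge : (G : Graph n) (a c : Fin n) → a ≢ c → Graph n
addEdge G a c a≢c = record
  { Adj    = λ x y → Adj G x y ⊎ (x ≡ a × y ≡ c) ⊎ (x ≡ c × y ≡ a)
  ; adj?   = λ x y → adj? G x y ⊎-dec (x ≟ a ×-dec y ≟ c) ⊎-dec (x ≟ c ×-dec y ≟ a)
  ; sym    = λ { (inj₁ xy)                  → inj₁ (Adj-sym G xy)
               ; (inj₂ (inj₁ (x≡a , y≡c))) → inj₂ (inj₂ (y≡c , x≡a))
               ; (inj₂ (inj₂ (x≡c , y≡a))) → inj₂ (inj₁ (y≡a , x≡c)) }
  ; irrefl = λ { (inj₁ xx)                  → irrefl G xx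
               ; (inj₂ (inj₁ (x≡a , x≡c))) → a≢c (trans (sym x≡a) x≡c)
               ; (inj₂ (inj₂ (x≡c , x≡a))) → a≢c (trans (sym x≡a) x≡c) }
  }

-- A termination measure rather than an exact count: pairs u = w and u ∉ W contribute too,
-- but adding an edge inside W never increases any term.
nonEdges : Graph n → Subset n → ℕ
nonEdges G W = sum (tabulate λ u → ∣ W ─ nbhd G u ∣)

nonEdges-addEdge : ∀ (G : Graph n) {W a c} (a≢c : a ≢ c) → c ∈ W → ¬ Adj G a c →
                   nonEdges (addEdge G a c a≢c) W < nonEdges G W
nonEdges-addEdge G {W} {a} {c} a≢c c∈W ¬ac =
  sum-tabulate-< (λ u → p⊆q⇒∣p∣≤∣q∣ (fewer u)) a
    (p⊂q⇒∣p∣<∣q∣ (fewer a , c , x∈p∧x∉q⇒x∈p─q c∈W (¬ac ∘ ∈-nbhd⁻ G) ,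
                  λ c∈ → proj₂ (x∈p─q⁻ W _ c∈) (∈-nbhd⁺ G′ (inj₂ (inj₁ (refl , refl))))))
  where
  G′ = addEdge G a c a≢c
  fewer : ∀ u → W ─ nbhd G′ u ⊆ W ─ nbhd G u
  fewer u z∈ with x∈p─q⁻ W _ z∈
  ... | z∈W , z∉ = x∈p∧x∉q⇒x∈p─q z∈W (z∉ ∘ ∈-nbhd⁺ G′ ∘ inj₁ ∘ ∈-nbhd⁻ G)

Universal : Graph n → Subset n → Fin n → Set
Universal G W u = ∀ w → w ∈ W → w ≢ u → Adj G u w

Independent : Graph n → Subset n → Set
Independent G T = ∀ {s t} → s ∈ T → t ∈ T → ¬ Adj G s t

Connected : Graph n → Subset n → Fin n → Fin n → Set
Connected G A = Star (λ x y → Adj G x y × y ∈ A)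

-- Perfect matchings

record IsPerfectMatching (G : Graph n) (W : Subset n) (m : Fin n → Fin n) : Set where
  field
    involutive : ∀ x → m (m x) ≡ x
    adjacent   : x ∈ W → Adj G x (m x)
    fixed      : x ∉ W → m x ≡ x

  closed : x ∈ W → m x ∈ W
  closed {x} x∈W with m x ∈? W
  ... | yes mx∈W = mx∈W
  ... | no  mx∉W = contradiction (trans (sym (involutive x)) (fixed mx∉W)) (Adj⇒≢ G (adjacent x∈W))

  ─-closed : ∀ {Z} → (∀ {z} → z ∈ Z → m z ∈ Z) → ∀ {x} → x ∈ W ─ Z → m x ∈ W ─ Z
  ─-closed {Z} Z-closed {x} x∈W─Z with x∈p─q⁻ W Z x∈W─Z
  ... | x∈W , x∉Z = x∈p∧x∉q⇒x∈p─q (closed x∈W) λ mx∈Z → x∉Z (subst (_∈ Z) (involutive x) (Z-closed mx∈Z))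

PerfectMatching : Graph n → Subset n → Set
PerfectMatching G W = ∃ (IsPerfectMatching G W)

splice : Subset n → (Fin n → Fin n) → (Fin n → Fin n) → Fin n → Fin n
splice Y m₁ m₂ x with x ∈? Y
... | yes _ = m₁ x
... | no  _ = m₂ x

module _ {Y : Subset n} {m₁ m₂ : Fin n → Fin n} where

  splice-∈ : x ∈ Y → splice Y m₁ m₂ x ≡ m₁ x
  splice-∈ {x} x∈Y with x ∈? Y
  ... | yes _   = refl
  ... | no  x∉Y = contradiction x∈Y x∉Y

  splice-∉ : x ∉ Y → splice Y m₁ m₂ x ≡ m₂ x
  splice-∉ {x} x∉Y with x ∈? Y
  ... | yes x∈Y = contradiction x∈Y x∉Y
  ... | no  _   = refl

module _ {x y : Fin n} where

  transpose-matchˡ : transpose x y x ≡ y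
  transpose-matchˡ with x ≟ x
  ... | yes _  = refl
  ... | no x≢x = contradiction refl x≢x

  transpose-matchʳ : transpose x y y ≡ x
  transpose-matchʳ with y ≟ x
  ... | yes y≡x = y≡x
  ... | no _ with y ≟ y
  ...   | yes _  = refl
  ...   | no y≢y = contradiction refl y≢y

  transpose-mismatch : z ≢ x → z ≢ y → transpose x y z ≡ z
  transpose-mismatch {z} z≢x z≢y with z ≟ x
  ... | yes z≡x = contradiction z≡x z≢x
  ... | no _ with z ≟ y
  ...   | yes z≡y = contradiction z≡y z≢y
  ...   | no _    = refl

  transpose-involutive : ∀ z → transpose x y (transpose x y z) ≡ z
  transpose-involutive z = by-cases (z ≟ x) (z ≟ y)
    where
    by-cases : Dec (z ≡ x) → Dec (z ≡ y) → transpose x y (transpose x y z) ≡ z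
    by-cases (yes refl) _          = trans (cong (transpose x y) transpose-matchˡ) transpose-matchʳ
    by-cases (no _)     (yes refl) = trans (cong (transpose x y) transpose-matchʳ) transpose-matchˡ
    by-cases (no z≢x)   (no z≢y)   =
      trans (cong (transpose x y) (transpose-mismatch z≢x z≢y)) (transpose-mismatch z≢x z≢y)

module _ {G : Graph n} where

  empty-matching : ∀ {W} → Empty W → PerfectMatching G W
  empty-matching ¬ne = id , record
    { involutive = λ _ → refl ; adjacent = λ x∈W → contradiction (_ , x∈W) ¬ne ; fixed = λ _ → refl }

  pair-matching : Adj G x y → IsPerfectMatching G (⁅ x ⁆ ∪ ⁅ y ⁆) (transpose x y)
  pair-matching {x} {y} xy = record
    { involutive = transpose-involutive
    ; adjacent   = adjacent
    ; fixed      = λ z∉ → transpose-mismatch (z∉ ∘ ∈-pair⁺ ∘ inj₁) (z∉ ∘ ∈-pair⁺ ∘ inj₂)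
    }
    where
    adjacent : z ∈ ⁅ x ⁆ ∪ ⁅ y ⁆ → Adj G z (transpose x y z)
    adjacent z∈ with ∈-pair⁻ z∈
    ... | inj₁ refl = subst (Adj G x) (sym (transpose-matchˡ {x = x} {y})) xy
    ... | inj₂ refl = subst (Adj G y) (sym (transpose-matchʳ {x = x} {y})) (Adj-sym G xy)

  drop-edge : ∀ {W a c a≢c m} → IsPerfectMatching (addEdge G a c a≢c) W m → m a ≢ c →
              IsPerfectMatching G W m
  drop-edge {W} {m = m} M ma≢c = record { IsPerfectMatching M ; adjacent = adjacent }
    where
    module M = IsPerfectMatching M
    adjacent : x ∈ W → Adj G x (m x)
    adjacent {x} x∈W with M.adjacent x∈W
    ... | inj₁ x∼mx                 = x∼mx
    ... | inj₂ (inj₁ (refl , mx≡c)) = contradiction mx≡c ma≢c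
    ... | inj₂ (inj₂ (refl , mx≡a)) = contradiction (trans (cong m (sym mx≡a)) (M.involutive x)) ma≢c

  drop-edge-∉ : ∀ {W a c} (a≢c : a ≢ c) → PerfectMatching (addEdge G a c a≢c) W → a ∉ W →
                PerfectMatching G W
  drop-edge-∉ a≢c (m , M) a∉W =
    m , drop-edge {a≢c = a≢c} M (λ ma≡c → a≢c (trans (sym (IsPerfectMatching.fixed M a∉W)) ma≡c))

  restrict : ∀ {W Z m} → IsPerfectMatching G W m → Z ⊆ W → (∀ {x} → x ∈ Z → m x ∈ Z) →
             IsPerfectMatching G Z (splice Z m id)
  restrict {Z = Z} {m} M Z⊆W Z-closed = record
    { involutive = involutive
    ; adjacent   = λ {x} x∈Z → subst (Adj G x) (sym (splice-∈ x∈Z)) (M.adjacent (Z⊆W x∈Z))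
    ; fixed      = splice-∉
    }
    where
    module M = IsPerfectMatching M
    involutive : ∀ x → splice Z m id (splice Z m id x) ≡ x
    involutive x with x ∈? Z
    ... | yes x∈Z = trans (splice-∈ (Z-closed x∈Z)) (M.involutive x)
    ... | no  x∉Z = splice-∉ x∉Z

  glue : ∀ {W Y m₁ m₂} → Y ⊆ W → IsPerfectMatching G Y m₁ → IsPerfectMatching G (W ─ Y) m₂ →
         IsPerfectMatching G W (splice Y m₁ m₂)
  glue {W} {Y} {m₁} {m₂} Y⊆W M₁ M₂ =
    record { involutive = involutive ; adjacent = adjacent ; fixed = fixed }
    where
    module M₁ = IsPerfectMatching M₁
    module M₂ = IsPerfectMatching M₂
    m₂-preserves-∉ : x ∉ Y → m₂ x ∉ Y
    m₂-preserves-∉ {x} x∉Y with x ∈? W ─ Y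
    ... | yes x∈W─Y = proj₂ (x∈p─q⁻ W Y (M₂.closed x∈W─Y))
    ... | no  x∉W─Y = subst (_∉ Y) (sym (M₂.fixed x∉W─Y)) x∉Y
    involutive : ∀ x → splice Y m₁ m₂ (splice Y m₁ m₂ x) ≡ x
    involutive x with x ∈? Y
    ... | yes x∈Y = trans (splice-∈ (M₁.closed x∈Y)) (M₁.involutive x)
    ... | no  x∉Y = trans (splice-∉ (m₂-preserves-∉ x∉Y)) (M₂.involutive x)
    adjacent : x ∈ W → Adj G x (splice Y m₁ m₂ x)
    adjacent {x} x∈W with x ∈? Y
    ... | yes x∈Y = M₁.adjacent x∈Y
    ... | no  x∉Y = M₂.adjacent (x∈p∧x∉q⇒x∈p─q x∈W x∉Y)
    fixed : x ∉ W → splice Y m₁ m₂ x ≡ x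
    fixed x∉W = trans (splice-∉ (x∉W ∘ Y⊆W)) (M₂.fixed (x∉W ∘ proj₁ ∘ x∈p─q⁻ W Y))

  extend : ∀ {W} → x ∈ W → y ∈ W → Adj G x y → PerfectMatching G (W - x - y) → PerfectMatching G W
  extend {x} {y} {W} x∈W y∈W xy (m , M) =
    _ , glue pair⊆W (pair-matching xy)
             (subst (λ V → IsPerfectMatching G V m) (p─q─r≡p─q∪r W ⁅ x ⁆ ⁅ y ⁆) M)
    where
    pair⊆W : ⁅ x ⁆ ∪ ⁅ y ⁆ ⊆ W
    pair⊆W z∈ with ∈-pair⁻ z∈
    ... | inj₁ refl = x∈W
    ... | inj₂ refl = y∈W

-- Lovász's proof of Tutte's theorem

module _ {G : Graph n} {U : Subset n} where

  match-balanced : ∀ {W} → Acc _⊂_ W → (∀ {u} → u ∈ U → Universal G W u) →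
                   ∣ W ─ U ∣ ≤ ∣ W ∩ U ∣ → 2 ∣ ∣ W ∣ → PerfectMatching G W
  match-balanced {W} (acc rec) univ balanced even = by-cases (nonempty? (W ─ U)) (nonempty? W)
    where
    continue : x ∈ W → y ∈ W - x → Adj G x y → ∣ W - x - y ─ U ∣ ≤ ∣ (W - x - y) ∩ U ∣ →
               PerfectMatching G W
    continue {x} {y} x∈W y∈W-x xy balanced′ =
      extend x∈W (proj₁ (x∈p-y⁻ W x y∈W-x)) xy
        (match-balanced (rec (p-x-y⊂p y x∈W)) (λ u∈U w w∈ → univ u∈U w (proj₁ (x∈p-y-z⁻ w∈)))
          balanced′ (2∣∣p-x-y∣ x∈W y∈W-x even))

    by-cases : Dec (Nonempty (W ─ U)) → Dec (Nonempty W) → PerfectMatching G W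
    by-cases (yes (x , x∈W─U)) _
      with x∈p─q⁻ W U x∈W─U | 0<∣p∣⇒Nonempty (≤-trans (x∈p⇒0<∣p∣ x∈W─U) balanced)
    ... | x∈W , x∉U | u , u∈W∩U with x∈p∩q⁻ W U u∈W∩U
    ...   | u∈W , u∈U =
      continue x∈W (x∈p∧x≢y⇒x∈p-y u∈W u≢x) (Adj-sym G (univ u∈U x x∈W (u≢x ∘ sym)))
        (∣p-x-y─q∣≤∣p-x-y∩q∣ W U x∈W─U u∈W∩U balanced)
      where
      u≢x : u ≢ x
      u≢x refl = x∉U u∈U
    by-cases (no ¬ne) (yes (u , u∈W)) with 2∣∣p∣⇒Nonempty[p-x] u∈W even
    ... | u′ , u′∈W-u with x∈p-y⁻ W u u′∈W-u
    ...   | u′∈W , u′≢u =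
      continue u∈W u′∈W-u (univ (∈U u∈W) u′ u′∈W u′≢u)
        (subst (_≤ ∣ (W - u - u′) ∩ U ∣) (sym (Empty⇒∣p∣≡0 (¬ne ∘ shrink))) z≤n)
      where
      ∈U : z ∈ W → z ∈ U
      ∈U {z} z∈W with z ∈? U
      ... | yes z∈U = z∈U
      ... | no  z∉U = contradiction (z , x∈p∧x∉q⇒x∈p─q z∈W z∉U) ¬ne
      shrink : Nonempty (W - u - u′ ─ U) → Nonempty (W ─ U)
      shrink (z , z∈) = z , p─q⊆p (W ─ U) ⁅ u ⁆ (p-x-y─q⊆p─q-x W U u u′ z∈)
    by-cases (no _) (no ¬ne) = empty-matching ¬ne

  match-cliques : ∀ {W} → Acc _⊂_ W → (∀ {u} → u ∈ U → Universal G W u) →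
                  (∀ {T} → T ⊆ W ─ U → Independent G T → ∣ T ∣ ≤ suc ∣ W ∩ U ∣) →
                  2 ∣ ∣ W ∣ → PerfectMatching G W
  match-cliques {W} (acc rec) univ few even
    with any? (λ x → any? (λ y → x ∈? W ─ U ×-dec y ∈? W ─ U ×-dec adj? G x y))
  ... | yes (x , y , x∈W─U , y∈W─U , xy) with x∈p─q⁻ W U x∈W─U | x∈p─q⁻ W U y∈W─U
  ...   | x∈W , x∉U | y∈W , y∉U =
    extend x∈W y∈W xy
      (match-cliques (rec (p-x-y⊂p y x∈W)) (λ u∈U w w∈ → univ u∈U w (proj₁ (x∈p-y-z⁻ w∈))) few′
        (2∣∣p-x-y∣ x∈W (x∈p∧x≢y⇒x∈p-y y∈W (Adj⇒≢ G (Adj-sym G xy))) even))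
    where
    few′ : ∀ {T} → T ⊆ W - x - y ─ U → Independent G T → ∣ T ∣ ≤ suc ∣ (W - x - y) ∩ U ∣
    few′ T⊆ indep = ≤-trans (few (p─q⊆p (W ─ U) ⁅ x ⁆ ∘ p-x-y─q⊆p─q-x W U x y ∘ T⊆) indep)
                            (s≤s (p⊆q⇒∣p∣≤∣q∣ (p∩q⊆p-x-y∩q W U x∉U y∉U)))
  match-cliques {W} _ univ few even | no ¬edge = match-balanced (⊂-wellFounded W) univ
    (2∣m+n∧n≤1+m⇒n≤m (subst (2 ∣_) (∣p∣≡∣p∩q∣+∣p─q∣ W U) even)
      (few id λ s∈ t∈ st → ¬edge (_ , _ , s∈ , t∈ , st))) even

-- "G[W] − X has at most ∣X∣ + 1 components", with T ranging over sets of vertices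
-- from pairwise different components
ComponentBound : Graph n → Subset n → Set
ComponentBound G W =
  ∀ X {T} → T ⊆ W ─ X → (∀ {s t} → s ∈ T → t ∈ T → s ≢ t → ¬ Connected G (W ─ X) s t) →
  ∣ T ∣ ≤ suc ∣ X ∣

ComponentBound-mono : ∀ {G G′ : Graph n} {W} → (∀ {x y} → Adj G x y → Adj G′ x y) →
                      ComponentBound G W → ComponentBound G′ W
ComponentBound-mono G⊆G′ bound X T⊆ separated =
  bound X T⊆ λ s∈ t∈ s≢t → separated s∈ t∈ s≢t ∘ Star.map (map₁ G⊆G′)

-- When there is none, the vertices of W that are not universal span a disjoint union of cliques.
Obstruction : Graph n → Subset n → Fin n → Fin n → Fin n → Fin n → Set
Obstruction G W a b c d =
  a ∈ W × b ∈ W × c ∈ W × d ∈ W ×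
  Adj G a b × Adj G b c × a ≢ c × ¬ Adj G a c × b ≢ d × ¬ Adj G b d

module _ (G : Graph n) (W : Subset n) where

  obstruction? : Dec (∃ λ a → ∃ λ b → ∃ λ c → ∃ λ d → Obstruction G W a b c d)
  obstruction? = any? λ a → any? λ b → any? λ c → any? λ d →
    a ∈? W ×-dec b ∈? W ×-dec c ∈? W ×-dec d ∈? W ×-dec adj? G a b ×-dec adj? G b c ×-dec
    ¬? (a ≟ c) ×-dec ¬? (adj? G a c) ×-dec ¬? (b ≟ d) ×-dec ¬? (adj? G b d)

  universal? : Decidable (Universal G W)
  universal? u = all? λ w → w ∈? W →-dec ¬? (w ≟ u) →-dec adj? G u w

  ¬Universal⇒nonNeighbour : ∀ {u} → ¬ Universal G W u → ∃ λ d → d ∈ W × d ≢ u × ¬ Adj G u d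
  ¬Universal⇒nonNeighbour {u} ¬univ with ¬∀⟶∃¬ n _ (λ w → w ∈? W →-dec ¬? (w ≟ u) →-dec adj? G u w) ¬univ
  ... | d , ¬edge with d ∈? W | d ≟ u | adj? G u d
  ...   | yes d∈W | no d≢u  | no ¬ud = d , d∈W , d≢u , ¬ud
  ...   | no d∉W  | _       | _      = contradiction (λ d∈W → contradiction d∈W d∉W) ¬edge
  ...   | yes _   | yes d≡u | _      = contradiction (λ _ d≢u → contradiction d≡u d≢u) ¬edge
  ...   | yes _   | no _    | yes ud = contradiction (λ _ _ → ud) ¬edge

  module _ (unobstructed : ∀ {a b c d} → ¬ Obstruction G W a b c d) where

    nonUniversal-transitive : ∀ {a b c} → b ∈ W → ¬ Universal G W b → a ∈ W → c ∈ W →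
                              Adj G a b → Adj G b c → a ≢ c → Adj G a c
    nonUniversal-transitive {a} {c = c} b∈W ¬univ a∈W c∈W ab bc a≢c with adj? G a c
    ... | yes ac = ac
    ... | no ¬ac with ¬Universal⇒nonNeighbour ¬univ
    ...   | d , d∈W , d≢b , ¬bd =
      contradiction (a∈W , b∈W , c∈W , d∈W , ab , bc , a≢c , ¬ac , d≢b ∘ sym , ¬bd) unobstructed

    connected⇒adjacent : ∀ {A s t} → A ⊆ W → (∀ {z} → z ∈ A → ¬ Universal G W z) →
                         s ∈ A → t ∈ A → Connected G A s t → s ≡ t ⊎ Adj G s t
    connected⇒adjacent A⊆W ¬univ s∈A t∈A ε = inj₁ refl
    connected⇒adjacent {s = s} {t} A⊆W ¬univ s∈A t∈A ((sz , z∈A) ◅ path)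
      with connected⇒adjacent A⊆W ¬univ z∈A t∈A path | s ≟ t
    ... | inj₁ refl | _       = inj₂ sz
    ... | inj₂ _    | yes s≡t = inj₁ s≡t
    ... | inj₂ zt   | no s≢t  =
      inj₂ (nonUniversal-transitive (A⊆W z∈A) (¬univ z∈A) (A⊆W s∈A) (A⊆W t∈A) sz zt s≢t)

module Orbit {G₁ G₂ : Graph n} {W : Subset n} {m₁ m₂ : Fin n → Fin n}
             (M₁ : IsPerfectMatching G₁ W m₁) (M₂ : IsPerfectMatching G₂ W m₂) where

  private
    module M₁ = IsPerfectMatching M₁
    module M₂ = IsPerfectMatching M₂

  step : Fin n → Fin n
  step = m₂ ∘ m₁

  step^ : ℕ → Fin n → Fin n
  step^ i x = fold x step i

  step-injective : step x ≡ step y → x ≡ y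
  step-injective {x} {y} eq = begin
    x                   ≡⟨ M₁.involutive x ⟨
    m₁ (m₁ x)           ≡⟨ cong m₁ (M₂.involutive (m₁ x)) ⟨
    m₁ (m₂ (m₂ (m₁ x))) ≡⟨ cong (m₁ ∘ m₂) eq ⟩
    m₁ (m₂ (m₂ (m₁ y))) ≡⟨ cong m₁ (M₂.involutive (m₁ y)) ⟩
    m₁ (m₁ y)           ≡⟨ M₁.involutive y ⟩
    y                   ∎
    where open ≡-Reasoning

  step^-injective : ∀ i → step^ i x ≡ step^ i y → x ≡ y
  step^-injective zero    eq = eq
  step^-injective (suc i) eq = step^-injective i (step-injective eq)

  step^-step : ∀ i → step^ i (step x) ≡ step (step^ i x)
  step^-step zero    = refl
  step^-step (suc i) = cong step (step^-step i)

  step^-∈ : ∀ i → x ∈ W → step^ i x ∈ W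
  step^-∈ zero    x∈W = x∈W
  step^-∈ (suc i) x∈W = M₂.closed (M₁.closed (step^-∈ i x∈W))

  returns : ∀ x → ∃ λ k → step^ (suc k) x ≡ x
  returns x with pigeonhole (n<1+n n) (λ i → step^ (toℕ i) x)
  ... | i , j , i<j , same = k , step^-injective (toℕ i) (begin
    step^ (toℕ i) (step^ (suc k) x) ≡⟨ fold-+ x step (toℕ i) ⟨
    step^ (toℕ i + suc k) x         ≡⟨ cong (λ l → step^ l x) (trans (+-suc (toℕ i) k) (m+[n∸m]≡n i<j)) ⟩
    step^ (toℕ j) x                 ≡⟨ same ⟨
    step^ (toℕ i) x                 ∎)
    where
    open ≡-Reasoning
    k = toℕ j ∸ suc (toℕ i)

  -- step moves two edges along the M₁/M₂-alternating cycle through x, so the orbit of x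
  -- visits only the even positions of that cycle, while m₁ x sits at an odd one.
  step^≢m₁ : ∀ i → x ∈ W → step^ i x ≢ m₁ x
  step^≢m₁ zero          x∈W = Adj⇒≢ G₁ (M₁.adjacent x∈W)
  step^≢m₁ (suc zero)    x∈W = Adj⇒≢ G₂ (M₂.adjacent (M₁.closed x∈W)) ∘ sym
  step^≢m₁ {x} (suc (suc i)) x∈W eq =
    step^≢m₁ i (step^-∈ 1 x∈W) (step-injective (trans (cong step (step^-step i)) (trans eq (sym back))))
    where
    back : step (m₁ (step x)) ≡ m₁ x
    back = trans (cong m₂ (M₁.involutive (step x))) (M₂.involutive (m₁ x))

-- Follow the walk d, m₁ d, step d, m₁ (step d), … until step^ (suc i₀) d first lands on a, c
-- or d, and let Y be the vertices visited before. M₁ matches Y without using ac. If the walk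
-- returns to d, M₂ matches W ─ Y without using bd; otherwise it stops at some a′ ∈ {a, c},
-- and the edge a′b together with M₂ matches W ─ Y.
module AlternatingCycle
  {G : Graph n} {W : Subset n} {a b c d : Fin n} {a≢c : a ≢ c} {b≢d : b ≢ d} {m₁ m₂ : Fin n → Fin n}
  (M₁ : IsPerfectMatching (addEdge G a c a≢c) W m₁) (m₁a≡c : m₁ a ≡ c)
  (M₂ : IsPerfectMatching (addEdge G b d b≢d) W m₂) (m₂b≡d : m₂ b ≡ d)
  (b∈W : b ∈ W) (d∈W : d ∈ W) (ab : Adj G a b) (bc : Adj G b c) (¬bd : ¬ Adj G b d)
  where

  open Orbit M₁ M₂
  private
    module M₁ = IsPerfectMatching M₁
    module M₂ = IsPerfectMatching M₂

  d≢a : d ≢ a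
  d≢a refl = ¬bd (Adj-sym G ab)

  d≢c : d ≢ c
  d≢c refl = ¬bd bc

  m₁c≡a : m₁ c ≡ a
  m₁c≡a = trans (cong m₁ (sym m₁a≡c)) (M₁.involutive a)

  Stop : ℕ → Set
  Stop i = step^ (suc i) d ≡ a ⊎ step^ (suc i) d ≡ c ⊎ step^ (suc i) d ≡ d

  stop? : Decidable Stop
  stop? i = step^ (suc i) d ≟ a ⊎-dec step^ (suc i) d ≟ c ⊎-dec step^ (suc i) d ≟ d

  module FirstStop (i₀ : ℕ) (¬stop : ∀ {k} → k < i₀ → ¬ Stop k) where

    end : Fin n
    end = step^ (suc i₀) d

    OnWalk : Fin n → Set
    OnWalk x = ∃ λ i → i < suc i₀ × (x ≡ step^ i d ⊎ x ≡ m₁ (step^ i d))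

    onWalk? : Decidable OnWalk
    onWalk? x = anyUpTo? (λ i → x ≟ step^ i d ⊎-dec x ≟ m₁ (step^ i d)) (suc i₀)

    Y : Subset n
    Y = select onWalk?

    ∈Y⁺ : ∀ i → i < suc i₀ → x ≡ step^ i d ⊎ x ≡ m₁ (step^ i d) → x ∈ Y
    ∈Y⁺ i i<j on = ∈-select⁺ onWalk? (i , i<j , on)

    ∈Y⁻ : x ∈ Y → OnWalk x
    ∈Y⁻ = ∈-select⁻ onWalk?

    walk-avoids-ac : ∀ {i} → i < suc i₀ → step^ i d ≢ a × step^ i d ≢ c
    walk-avoids-ac {zero}  _     = d≢a , d≢c
    walk-avoids-ac {suc i} 1+i<j = ¬stop (s≤s⁻¹ 1+i<j) ∘ inj₁ , ¬stop (s≤s⁻¹ 1+i<j) ∘ inj₂ ∘ inj₁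

    walk-avoids-d : ∀ {i} → i < i₀ → step^ (suc i) d ≢ d
    walk-avoids-d i<i₀ = ¬stop i<i₀ ∘ inj₂ ∘ inj₂

    ∉Y : (∀ {i} → i < suc i₀ → step^ i d ≢ x × step^ i d ≢ m₁ x) → x ∉ Y
    ∉Y avoids x∈Y with ∈Y⁻ x∈Y
    ... | i , i<j , inj₁ x≡ = proj₁ (avoids i<j) (sym x≡)
    ... | i , i<j , inj₂ x≡ = proj₂ (avoids i<j) (trans (sym (M₁.involutive _)) (cong m₁ (sym x≡)))

    a∉Y : a ∉ Y
    a∉Y = ∉Y λ i<j → proj₁ (walk-avoids-ac i<j) , subst (_ ≢_) (sym m₁a≡c) (proj₂ (walk-avoids-ac i<j))

    c∉Y : c ∉ Y
    c∉Y = ∉Y λ i<j → proj₂ (walk-avoids-ac i<j) , subst (_ ≢_) (sym m₁c≡a) (proj₁ (walk-avoids-ac i<j))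

    d∈Y : d ∈ Y
    d∈Y = ∈Y⁺ 0 (s≤s z≤n) (inj₁ refl)

    Y⊆W : Y ⊆ W
    Y⊆W x∈Y with ∈Y⁻ x∈Y
    ... | i , _ , inj₁ refl = step^-∈ i d∈W
    ... | i , _ , inj₂ refl = M₁.closed (step^-∈ i d∈W)

    Y-m₁ : x ∈ Y → m₁ x ∈ Y
    Y-m₁ x∈Y with ∈Y⁻ x∈Y
    ... | i , i<j , inj₁ refl = ∈Y⁺ i i<j (inj₂ refl)
    ... | i , i<j , inj₂ refl = ∈Y⁺ i i<j (inj₁ (M₁.involutive _))

    m₂end∈Y : m₂ end ∈ Y
    m₂end∈Y = ∈Y⁺ i₀ ≤-refl (inj₂ (M₂.involutive _))

    m₂b∈Y : m₂ b ∈ Y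
    m₂b∈Y = subst (_∈ Y) (sym m₂b≡d) d∈Y

    Y-m₂ : x ∈ Y → m₂ x ∈ Y ⊎ m₂ x ≡ end ⊎ m₂ x ≡ b
    Y-m₂ x∈Y with ∈Y⁻ x∈Y
    ... | zero  , _     , inj₁ refl = inj₂ (inj₂ (trans (cong m₂ (sym m₂b≡d)) (M₂.involutive b)))
    ... | suc i , 1+i<j , inj₁ refl = inj₁ (∈Y⁺ i (<-trans (n<1+n i) 1+i<j) (inj₂ (M₂.involutive _)))
    ... | i     , i<j   , inj₂ refl with m≤n⇒m<n∨m≡n (s≤s⁻¹ i<j)
    ...   | inj₁ i<i₀ = inj₁ (∈Y⁺ (suc i) (s≤s i<i₀) (inj₁ refl))
    ...   | inj₂ refl = inj₂ (inj₁ refl)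

    matchingY : PerfectMatching G Y
    matchingY = drop-edge-∉ a≢c (_ , restrict M₁ Y⊆W Y-m₁) a∉Y

    closedWalk : end ≡ d → PerfectMatching G W
    closedWalk end≡d = _ , glue Y⊆W (proj₂ matchingY) (proj₂ rest)
      where
      b∈Y : b ∈ Y
      b∈Y = subst (_∈ Y) (trans (cong m₂ (trans end≡d (sym m₂b≡d))) (M₂.involutive b)) m₂end∈Y
      Y-closed : x ∈ Y → m₂ x ∈ Y
      Y-closed x∈Y with Y-m₂ x∈Y
      ... | inj₁ m₂x∈Y        = m₂x∈Y
      ... | inj₂ (inj₁ m₂x≡e) = subst (_∈ Y) (sym (trans m₂x≡e end≡d)) d∈Y
      ... | inj₂ (inj₂ m₂x≡b) = subst (_∈ Y) (sym m₂x≡b) b∈Y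
      rest : PerfectMatching G (W ─ Y)
      rest = drop-edge-∉ b≢d (_ , restrict M₂ (p─q⊆p W Y) (M₂.─-closed Y-closed))
                         (λ b∈ → proj₂ (x∈p─q⁻ W Y b∈) b∈Y)

    openWalk : ∀ {a′} → end ≡ a′ → a′ ∉ Y → d ≢ a′ → Adj G a′ b → PerfectMatching G W
    openWalk refl e∉Y d≢e eb = _ , glue Y⊆W (proj₂ matchingY) (glue P⊆W─Y (pair-matching eb) rest)
      where
      P = ⁅ end ⁆ ∪ ⁅ b ⁆
      b∉Y : b ∉ Y
      b∉Y b∈Y with ∈Y⁻ b∈Y
      ... | zero  , _ , inj₁ b≡d = b≢d b≡d
      ... | suc i , _ , inj₁ b≡ = step^≢m₁ i d∈W (sym (begin
        m₁ d                      ≡⟨ cong m₁ (trans (sym m₂b≡d) (cong m₂ b≡)) ⟩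
        m₁ (m₂ (step^ (suc i) d)) ≡⟨ cong m₁ (M₂.involutive _) ⟩
        m₁ (m₁ (step^ i d))       ≡⟨ M₁.involutive _ ⟩
        step^ i d                 ∎))
        where open ≡-Reasoning
      ... | i , i<j , inj₂ b≡ with m≤n⇒m<n∨m≡n (s≤s⁻¹ i<j)
      ...   | inj₁ i<i₀ = walk-avoids-d i<i₀ (trans (cong m₂ (sym b≡)) m₂b≡d)
      ...   | inj₂ refl = d≢e (sym (trans (cong m₂ (sym b≡)) m₂b≡d))
      Y∪P-closed : x ∈ Y ∪ P → m₂ x ∈ Y ∪ P
      Y∪P-closed x∈ with x∈p∪q⁻ Y P x∈
      ... | inj₁ x∈Y with Y-m₂ x∈Y
      ...   | inj₁ m₂x∈Y   = x∈p∪q⁺ (inj₁ m₂x∈Y)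
      ...   | inj₂ m₂x∈P   = x∈p∪q⁺ (inj₂ (∈-pair⁺ m₂x∈P))
      Y∪P-closed x∈ | inj₂ x∈P with ∈-pair⁻ x∈P
      ... | inj₁ refl = x∈p∪q⁺ (inj₁ m₂end∈Y)
      ... | inj₂ refl = x∈p∪q⁺ (inj₁ m₂b∈Y)
      P⊆W─Y : P ⊆ W ─ Y
      P⊆W─Y x∈P with ∈-pair⁻ x∈P
      ... | inj₁ refl = x∈p∧x∉q⇒x∈p─q (step^-∈ (suc i₀) d∈W) e∉Y
      ... | inj₂ refl = x∈p∧x∉q⇒x∈p─q b∈W b∉Y
      rest : IsPerfectMatching G (W ─ Y ─ P) (splice (W ─ (Y ∪ P)) m₂ id)
      rest = subst (λ V → IsPerfectMatching G V (splice (W ─ (Y ∪ P)) m₂ id)) (sym (p─q─r≡p─q∪r W Y P))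
        (proj₂ (drop-edge-∉ b≢d (_ , restrict M₂ (p─q⊆p W (Y ∪ P)) (M₂.─-closed Y∪P-closed))
                            λ b∈ → proj₂ (x∈p─q⁻ W _ b∈) (x∈p∪q⁺ (inj₂ (∈-pair⁺ (inj₂ refl))))))

    matching : Stop i₀ → PerfectMatching G W
    matching (inj₁ end≡a)        = openWalk end≡a a∉Y d≢a ab
    matching (inj₂ (inj₁ end≡c)) = openWalk end≡c c∉Y d≢c (Adj-sym G bc)
    matching (inj₂ (inj₂ end≡d)) = closedWalk end≡d

  matching : PerfectMatching G W
  matching with least-witness stop? {proj₁ (returns d)} (inj₂ (inj₂ (proj₂ (returns d))))
  ... | i₀ , stop , ¬stop = FirstStop.matching i₀ ¬stop stop

tutte : ∀ {W} (G : Graph n) → Acc _<_ (nonEdges G W) → ComponentBound G W → 2 ∣ ∣ W ∣ →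
        PerfectMatching G W
tutte {W = W} G (acc rec) bound even = by-cases (obstruction? G W)
  where
  with-edge : ∀ {a c} (a≢c : a ≢ c) → c ∈ W → ¬ Adj G a c → PerfectMatching (addEdge G a c a≢c) W
  with-edge {a} {c} a≢c c∈W ¬ac =
    tutte (addEdge G a c a≢c) (rec (nonEdges-addEdge G a≢c c∈W ¬ac))
          (ComponentBound-mono {G = G} {addEdge G a c a≢c} inj₁ bound) even

  by-cases : Dec (∃ λ a → ∃ λ b → ∃ λ c → ∃ λ d → Obstruction G W a b c d) → PerfectMatching G W
  by-cases (yes (a , b , c , d , a∈W , b∈W , c∈W , d∈W , ab , bc , a≢c , ¬ac , b≢d , ¬bd))
    with with-edge a≢c c∈W ¬ac | with-edge b≢d d∈W ¬bd
  ... | m₁ , M₁ | m₂ , M₂ with m₁ a ≟ c | m₂ b ≟ d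
  ...   | no m₁a≢c  | _         = m₁ , drop-edge {a≢c = a≢c} M₁ m₁a≢c
  ...   | yes _     | no m₂b≢d  = m₂ , drop-edge {a≢c = b≢d} M₂ m₂b≢d
  ...   | yes m₁a≡c | yes m₂b≡d =
    AlternatingCycle.matching {G = G} {a≢c = a≢c} {b≢d} M₁ m₁a≡c M₂ m₂b≡d b∈W d∈W ab bc ¬bd
  by-cases (no obstructed) = match-cliques (⊂-wellFounded W) (∈-select⁻ (universal? G W)) few even
    where
    U = select (universal? G W)
    few : ∀ {T} → T ⊆ W ─ U → Independent G T → ∣ T ∣ ≤ suc ∣ W ∩ U ∣
    few {T} T⊆W─U indep = bound (W ∩ U) T⊆ separated
      where
      T⊆ : T ⊆ W ─ (W ∩ U)
      T⊆ z∈T with x∈p─q⁻ W U (T⊆W─U z∈T)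
      ... | z∈W , z∉U = x∈p∧x∉q⇒x∈p─q z∈W (z∉U ∘ proj₂ ∘ x∈p∩q⁻ W U)
      ¬universal : z ∈ W ─ (W ∩ U) → ¬ Universal G W z
      ¬universal z∈ univ with x∈p─q⁻ W (W ∩ U) z∈
      ... | z∈W , z∉W∩U = z∉W∩U (x∈p∩q⁺ (z∈W , ∈-select⁺ (universal? G W) univ))
      separated : ∀ {s t} → s ∈ T → t ∈ T → s ≢ t → ¬ Connected G (W ─ (W ∩ U)) s t
      separated s∈T t∈T s≢t path
        with connected⇒adjacent G W (λ obs → obstructed (_ , _ , _ , _ , obs))
               (p─q⊆p W (W ∩ U)) ¬universal (T⊆ s∈T) (T⊆ t∈T) path
      ... | inj₁ s≡t = s≢t s≡t
      ... | inj₂ st  = indep s∈T t∈T st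

-- From β^k(G) ≥ 1 to the component bound in G − v

module _ {k} (G : Graph n) (2≤k : 2 ≤ k) (β : βGe1 k G) (v : Fin n) where

  private
    module Separated (X : Subset n) {T : Subset n} (T⊆ : T ⊆ ⊤ - v ─ X)
                     (separated : ∀ {s t} → s ∈ T → t ∈ T → s ≢ t → ¬ Connected G (⊤ - v ─ X) s t) where

      sharedNeighbour∈X∪⁅v⁆ : ∀ {u t₁ t₂} → t₁ ∈ T → t₂ ∈ T → t₁ ≢ t₂ → Adj G u t₁ → Adj G u t₂ →
                              u ∈ X ∪ ⁅ v ⁆
      sharedNeighbour∈X∪⁅v⁆ {u} t₁∈T t₂∈T t₁≢t₂ ut₁ ut₂ with u ∈? X | u ≟ v
      ... | yes u∈X | _        = x∈p∪q⁺ (inj₁ u∈X)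
      ... | no _    | yes refl = x∈p∪q⁺ (inj₂ (x∈⁅x⁆ v))
      ... | no u∉X  | no u≢v   = contradiction
        ((Adj-sym G ut₁ , x∈p∧x∉q⇒x∈p─q (x∈p∧x≢y⇒x∈p-y ∈⊤ u≢v) u∉X) ◅ (ut₂ , T⊆ t₂∈T) ◅ ε)
        (separated t₁∈T t₂∈T t₁≢t₂)

      bounded-via : ∀ S → ∣ T ∣ ≤ ∣ S ∣ → k ≤ ∣ S ∣ → (∃ λ t → t ∉ Λ k G S) → Λ k G S ⊆ X ∪ ⁅ v ⁆ →
                    ∣ T ∣ ≤ suc ∣ X ∣
      bounded-via S ∣T∣≤∣S∣ k≤∣S∣ (t , t∉Λ) Λ⊆ = begin
        ∣ T ∣             ≤⟨ ∣T∣≤∣S∣ ⟩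
        ∣ S ∣             ≤⟨ proj₂ β S k≤∣S∣ (λ Λ≡⊤ → t∉Λ (subst (t ∈_) (sym Λ≡⊤) ∈⊤)) ⟩
        ∣ Λ k G S ∣       ≤⟨ p⊆q⇒∣p∣≤∣q∣ Λ⊆ ⟩
        ∣ X ∪ ⁅ v ⁆ ∣     ≤⟨ ∣p∪q∣≤∣p∣+∣q∣ X ⁅ v ⁆ ⟩
        ∣ X ∣ + ∣ ⁅ v ⁆ ∣ ≡⟨ trans (cong (∣ X ∣ +_) (∣⁅x⁆∣≡1 v)) (+-comm _ 1) ⟩
        suc ∣ X ∣         ∎
        where open ≤-Reasoning

      few-components : ∣ T ∣ ≤ suc ∣ X ∣
      few-components with 2 ≤? ∣ T ∣
      ... | no ∣T∣<2 = ≤-trans (s≤s⁻¹ (≰⇒> ∣T∣<2)) (s≤s z≤n)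
      ... | yes 2≤∣T∣ with 2≤∣p∣⇒∃-pair 2≤∣T∣ | k ≤? ∣ T ∣
      ...   | t₁ , t₂ , t₁∈T , t₂∈T , t₁≢t₂ | yes k≤∣T∣ = bounded-via T ≤-refl k≤∣T∣ (t₁ , t₁∉Λ) Λ⊆
        where
        t₁∉Λ : t₁ ∉ Λ k G T
        t₁∉Λ t₁∈Λ with 0<∣p∣⇒Nonempty (≤-trans (≤-trans (s≤s z≤n) 2≤k) (∈-Λ⁻ G T t₁∈Λ))
        ... | s , s∈N∩T with x∈p∩q⁻ (nbhd G t₁) T s∈N∩T
        ...   | s∈N , s∈T = separated t₁∈T s∈T (Adj⇒≢ G (∈-nbhd⁻ G s∈N)) ((∈-nbhd⁻ G s∈N , T⊆ s∈T) ◅ ε)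
        Λ⊆ : Λ k G T ⊆ X ∪ ⁅ v ⁆
        Λ⊆ {u} u∈Λ with 2≤∣p∣⇒∃-pair (≤-trans 2≤k (∈-Λ⁻ G T u∈Λ))
        ... | s₁ , s₂ , s₁∈ , s₂∈ , s₁≢s₂ with x∈p∩q⁻ (nbhd G u) T s₁∈ | x∈p∩q⁻ (nbhd G u) T s₂∈
        ...   | s₁∈N , s₁∈T | s₂∈N , s₂∈T =
          sharedNeighbour∈X∪⁅v⁆ s₁∈T s₂∈T s₁≢s₂ (∈-nbhd⁻ G s₁∈N) (∈-nbhd⁻ G s₂∈N)
      ...   | t₁ , t₂ , t₁∈T , t₂∈T , t₁≢t₂ | no k≰∣T∣
        with ⊇-ofSize {p = T} k (<⇒≤ (≰⇒> k≰∣T∣)) (proj₁ β)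
      ...     | S , T⊆S , ∣S∣≡k =
        bounded-via S (subst (∣ T ∣ ≤_) (sym ∣S∣≡k) (<⇒≤ (≰⇒> k≰∣T∣))) (≤-reflexive (sym ∣S∣≡k))
                    (t₁ , t₁∉Λ) Λ⊆
        where
        S⊆nbhd : ∀ {u} → u ∈ Λ k G S → S ⊆ nbhd G u
        S⊆nbhd {u} u∈Λ =
          ∣q∣≤∣p∩q∣⇒q⊆p (nbhd G u) S (subst (_≤ ∣ nbhd G u ∩ S ∣) (sym ∣S∣≡k) (∈-Λ⁻ G S u∈Λ))
        t₁∉Λ : t₁ ∉ Λ k G S
        t₁∉Λ t₁∈Λ = irrefl G (∈-nbhd⁻ G (S⊆nbhd t₁∈Λ (T⊆S t₁∈T)))
        Λ⊆ : Λ k G S ⊆ X ∪ ⁅ v ⁆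
        Λ⊆ u∈Λ = sharedNeighbour∈X∪⁅v⁆ t₁∈T t₂∈T t₁≢t₂ (∈-nbhd⁻ G (S⊆nbhd u∈Λ (T⊆S t₁∈T)))
                                                      (∈-nbhd⁻ G (S⊆nbhd u∈Λ (T⊆S t₂∈T)))

  βGe1⇒ComponentBound : ComponentBound G (⊤ - v)
  βGe1⇒ComponentBound X = Separated.few-components X

2∣∣⊤-x∣ : ∀ m (x : Fin (suc (2 * m))) → 2 ∣ ∣ ⊤ - x ∣
2∣∣⊤-x∣ m x =
  divides m (trans (suc-injective (trans (sym (∣p∣≡1+∣p-x∣ {x = x} {p = ⊤} ∈⊤)) (∣⊤∣≡n (suc (2 * m)))))
                   (*-comm 2 m))

lemma3p4 : (k : ℕ) → 2 ≤ k → (m : ℕ) → (G : Graph (suc (2 * m))) →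
    βGe1 k G → Hypomatchable G
lemma3p4 k 2≤k m G β v
  with tutte {W = ⊤ - v} G (<-wellFounded _) (βGe1⇒ComponentBound G 2≤k β v) (2∣∣⊤-x∣ m v)
... | μ , M = μ , involutive , fixed (x∈q⇒x∉p─q (x∈⁅x⁆ v)) , λ u u≢v → adjacent (x∈p∧x≢y⇒x∈p-y ∈⊤ u≢v)
  where open IsPerfectMatching M
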